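{- Let $G$ be an oriented Burling graph. Then $G$ has a full in-star cutset, or $G$ is an oriented chandelier, or $G$ contains a vertex of degree at most $1$.
   Context: Rooted trees: for a rooted tree $(T,r)$ and $v\neq r$, $p(v)$ is the parent of $v$. A branch is a path $v_1v_2\dots v_k$ of $T$ with $v_i$ the parent of $v_{i+1}$ for all $i$ (it starts at $v_1$); a branch may be empty. A Burling tree is a 4-tuple $(T,r,\ell,c)$ where $T$ is a rooted tree with root $r$; $\ell$ assigns to every non-leaf vertex $v$ one of its children $\ell(v)$, the last-born of $v$; and $c$ is a function on $V(T)$ such that if $v\neq r$ is not a last-born then $c(v)$ is the vertex set of a (possibly empty) branch of $T$ starting at $\ell(p(v))$, while $c(v)=\varnothing$ if $v$ is the root or a last-born. The oriented graph fully derived from the Burling tree has vertex set $V(T)$ and an arc $uv$ iff $v\in c(u)$. An oriented graph is derived from the Burling tree if it is an induced subgraph of the fully derived oriented graph; an oriented Burling graph is an oriented graph derived from some Burling tree. Oriented graphs have no loops, no multiple arcs and no pair of opposite arcs; degree, neighbours, connectivity refer to the underlying graph. $N^-[v]$ denotes $v$ together with its in-neighbours. A full in-star cutset of an oriented graph $G$ is a set $N^-[v]$, $v\in V(G)$, such that $G\setminus N^-[v]$ is disconnected. An in-tree is an oriented graph obtained from a rooted tree by orienting every edge towards the root; a leaf of an in-tree is a source with exactly one out-neighbour. An oriented chandelier is an oriented graph obtained from an in-tree $G'$ with at least two leaves by adding a new vertex $v$ and all arcs $uv$ with $u$ a leaf of $G'$. -}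

module Defs where

open import Data.Nat using (ℕ; zero; suc; _≤_; _+_)
open import Data.Fin using (Fin)
open import Data.Bool using (Bool; true; false; if_then_else_; _∨_)
open import Data.Maybe using (Maybe; just; nothing)
open import Data.List using (List; []; _∷_; map; allFin)
open import Data.Nat.ListAction using (sum)
open import Data.List.Membership.Propositional using (_∈_)
open import Data.Product using (Σ; ∃; ∃-syntax; _×_; _,_)
open import Data.Sum using (_⊎_)
open import Relation.Nullary using (¬_)
open import Relation.Binary.PropositionalEquality using (_≡_; _≢_)
open import Function.Bundles using (_⇔_)
open import Function.Definitions using (Injective)

-- Finite oriented graphs on vertex set Fin n (Bool adjacency matrix):
-- no loops, no pair of opposite arcs (no multiple arcs by construction).

record OGraph : Set where
  field
    n       : ℕ
    arc     : Fin n → Fin n → Bool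
    irrefl  : ∀ u → arc u u ≡ false
    antisym : ∀ u v → arc u v ≡ true → arc v u ≡ false

module _ (G : OGraph) where
  open OGraph G

  adj : Fin n → Fin n → Bool
  adj u v = arc u v ∨ arc v u

  degree : Fin n → ℕ
  degree v = sum (map (λ u → if adj v u then 1 else 0) (allFin n))

  InClosedInNbhd : Fin n → Fin n → Set
  InClosedInNbhd v u = (u ≡ v) ⊎ (arc u v ≡ true)

  data Reach (S : Fin n → Set) (a : Fin n) : Fin n → Set where
    here : S a → Reach S a a
    step : ∀ {b c} → Reach S a b → adj b c ≡ true → S c → Reach S a c

  DisconnectedOn : (Fin n → Set) → Set
  DisconnectedOn S = ∃[ a ] ∃[ b ] (S a × S b × ¬ Reach S a b)

  FullInStarCutset : Fin n → Set
  FullInStarCutset v = DisconnectedOn (λ u → ¬ InClosedInNbhd v u)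

  HasFullInStarCutset : Set
  HasFullInStarCutset = ∃[ v ] FullInStarCutset v

  HasVertexOfDegreeAtMost1 : Set
  HasVertexOfDegreeAtMost1 = ∃[ v ] degree v ≤ 1

  -- G is an oriented chandelier: there is a vertex v such that G - v is an
  -- in-tree G' (a rooted tree on the vertices ≠ v, given by a parent map
  -- par with root rt and a depth function witnessing acyclicity, whose
  -- arcs are exactly u → par u), G' has at least two leaves, v has no
  -- out-neighbours, and the in-neighbours of v are exactly the leaves of G'.
  record ChandelierData (v : Fin n) : Set where
    field
      par   : Fin n → Maybe (Fin n)
      rt    : Fin n
      depth : Fin n → ℕ
      rt≢v      : rt ≢ v
      par-rt    : par rt ≡ nothing
      par-root  : ∀ u → u ≢ v → par u ≡ nothing → u ≡ rt
      par-in    : ∀ u w → u ≢ v → par u ≡ just w → w ≢ v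
      par-depth : ∀ u w → u ≢ v → par u ≡ just w → depth u ≡ suc (depth w)
      arcs-tree : ∀ u w → u ≢ v → w ≢ v → (arc u w ≡ true ⇔ par u ≡ just w)
    -- leaf of the in-tree G': a source (no in-neighbour in G') with exactly
    -- one out-neighbour (its parent) in G'
    Leaf : Fin n → Set
    Leaf u = u ≢ v × (∀ w → w ≢ v → par w ≢ just u) × (∃[ w ] par u ≡ just w)
    field
      two-leaves : ∃[ a ] ∃[ b ] (a ≢ b × Leaf a × Leaf b)
      v-no-out   : ∀ u → arc v u ≡ false
      v-in       : ∀ u → u ≢ v → (arc u v ≡ true ⇔ Leaf u)

  IsOrientedChandelier : Set
  IsOrientedChandelier = ∃[ v ] ChandelierData v

-- Burling trees. The rooted tree on Fin m is given by a parent map with a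
-- unique root and a depth function (acyclicity).

module _ {m : ℕ} (par : Fin m → Maybe (Fin m)) where
  data Chain : List (Fin m) → Set where
    single : ∀ x → Chain (x ∷ [])
    cons   : ∀ {x y l} → par y ≡ just x → Chain (y ∷ l) → Chain (x ∷ y ∷ l)

  data BranchFrom (s : Fin m) : List (Fin m) → Set where
    empty    : BranchFrom s []
    nonempty : ∀ {l} → Chain (s ∷ l) → BranchFrom s (s ∷ l)

record BurlingTree : Set where
  field
    m     : ℕ
    par   : Fin m → Maybe (Fin m)
    root  : Fin m
    depth : Fin m → ℕ
    par-root  : par root ≡ nothing
    root-uniq : ∀ u → par u ≡ nothing → u ≡ root
    par-depth : ∀ u w → par u ≡ just w → depth u ≡ suc (depth w)
    ℓ       : Fin m → Fin m
    ℓ-child : ∀ v w → par w ≡ just v → par (ℓ v) ≡ just v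
    -- c(v), given as the list of vertices of the branch (top-down)
    c          : Fin m → List (Fin m)
    c-root     : c root ≡ []
    c-lastborn : ∀ v u → par v ≡ just u → ℓ u ≡ v → c v ≡ []
    c-branch   : ∀ v u → par v ≡ just u → ℓ u ≢ v → BranchFrom par (ℓ u) (c v)

  DArc : Fin m → Fin m → Set
  DArc u v = v ∈ c u

DerivedFrom : OGraph → BurlingTree → Set
DerivedFrom G T =
  Σ (Fin (OGraph.n G) → Fin (BurlingTree.m T)) λ f →
    Injective _≡_ _≡_ f ×
    (∀ u w → (OGraph.arc G u w ≡ true ⇔ BurlingTree.DArc T (f u) (f w)))

IsOrientedBurlingGraph : OGraph → Set
IsOrientedBurlingGraph G = ∃[ T ] DerivedFrom G T

-- Embed G into the graph fully derived from a Burling tree T. An arc joins two vertices that are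
-- incomparable in T, the out-neighbours of a vertex lie on one branch and so are comparable, and
-- the rank 2·depth + [last-born] increases along arcs. If no vertex of G lies strictly below
-- another in T, a source of G has at most one neighbour. Otherwise let a be a deepest vertex of G
-- with a vertex of G strictly below it. A vertex outside the subtree of a that is not an
-- in-neighbour of a is separated by N⁻[a] from the part of G below a. If there is none, every
-- vertex has at most one out-neighbour other than a, so G − a is an in-forest whose leaves outside
-- the subtree are exactly the in-neighbours of a: a vertex of degree at most 1 or a second root
-- gives the conclusion, and otherwise G is a chandelier around a.

module Submission where

open import Defs
open import Data.Nat using (ℕ; zero; suc; _≤_; _<_; _+_; _*_; z≤n; s≤s)
open import Data.Nat.Properties
  using (≤-refl; ≤-reflexive; ≤-antisym; <-trans; ≤-<-trans; <-≤-trans; <-irrefl; <⇒≤; n<1+n;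
         +-comm; +-monoʳ-<; +-monoʳ-≤; *-monoʳ-≤; *-suc; m≤m+n; m<m+n; module ≤-Reasoning)
open import Data.Nat.ListAction using (sum)
open import Data.Fin using (Fin; zero; suc; fromℕ<)
open import Data.Fin.Properties using (_≟_; 0≢1+n; suc-injective; any?)
open import Data.Bool using (Bool; true; false; if_then_else_)
open import Data.Bool.Properties using (¬-not; not-¬) renaming (_≟_ to _≟ᴮ_)
open import Data.Maybe using (Maybe; just; nothing; maybe)
open import Data.Maybe.Properties using (just-injective) renaming (≡-dec to ≡-decᴹ)
open import Data.List using (List; []; _∷_; map; tabulate; allFin; filter)
open import Data.List.Properties using (map-tabulate)
open import Data.List.Extrema.Nat
  using (argmax; argmax-all; f[xs]≤f[argmax]; argmin; f[argmin]≤f[xs]; max; xs≤max)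
open import Data.List.Membership.Propositional using (_∈_)
open import Data.List.Membership.Propositional.Properties using (∈-filter⁺; ∈-allFin)
open import Data.List.Relation.Unary.Any using (here; there)
import Data.List.Relation.Unary.All as All
import Data.List.Relation.Unary.All.Properties as All
open import Data.Product using (∃; ∃-syntax; _×_; _,_; proj₁; proj₂)
open import Data.Sum using (_⊎_; inj₁; inj₂)
open import Data.Empty using (⊥; ⊥-elim)
open import Function using (id; _∘_)
open import Function.Bundles using (_⇔_; Equivalence; mk⇔)
open import Function.Definitions using (Injective)
open import Relation.Unary using (Decidable)
open import Relation.Nullary using (¬_; Dec; yes; no; does)
open import Relation.Nullary.Decidable using (map′; dec-true; dec-false; ¬?; _×-dec_; decidable-stable)
open import Relation.Binary.PropositionalEquality using (_≡_; _≢_; refl; sym; trans; cong; cong₂; subst)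

nothing≢just : ∀ {A : Set} {x : A} → nothing ≢ just x
nothing≢just ()

bit : Bool → ℕ
bit b = if b then 1 else 0

bit≤1 : ∀ b → bit b ≤ 1
bit≤1 true = ≤-refl
bit≤1 false = z≤n

sum-bits≡0 : ∀ {k} (g : Fin k → Bool) → (∀ u → g u ≡ false) → sum (tabulate (bit ∘ g)) ≡ 0
sum-bits≡0 {zero} g all-false = refl
sum-bits≡0 {suc k} g all-false rewrite all-false zero = sum-bits≡0 (g ∘ suc) (all-false ∘ suc)

sum-bits≤1 : ∀ {k} (g : Fin k → Bool) → (∀ u w → g u ≡ true → g w ≡ true → u ≡ w) →
             sum (tabulate (bit ∘ g)) ≤ 1
sum-bits≤1 {zero} g unique = z≤n
sum-bits≤1 {suc k} g unique with g zero in g0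
... | false = sum-bits≤1 (g ∘ suc) (λ u w gu gw → suc-injective (unique (suc u) (suc w) gu gw))
... | true = ≤-reflexive (cong suc (sum-bits≡0 (g ∘ suc) rest-false))
  where
  rest-false : ∀ u → g (suc u) ≡ false
  rest-false u = ¬-not (λ gu → 0≢1+n (unique zero (suc u) g0 gu))

degree≤1 : (G : OGraph) (v : Fin (OGraph.n G)) →
           (∀ u w → adj G v u ≡ true → adj G v w ≡ true → u ≡ w) → degree G v ≤ 1
degree≤1 G v unique =
  subst (_≤ 1) (cong sum (sym (map-tabulate id (bit ∘ adj G v)))) (sum-bits≤1 (adj G v) unique)

∃-maximal : ∀ {k} {Q : Fin k → Set} → Decidable Q → (μ : Fin k → ℕ) →
            ∃ Q → ∃[ x ] Q x × (∀ y → Q y → μ y ≤ μ x)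
∃-maximal {k} Q? μ (x₀ , Qx₀) =
  argmax μ x₀ xs , argmax-all μ Qx₀ (All.all-filter Q? (allFin k)) ,
  λ y Qy → All.lookup (f[xs]≤f[argmax] x₀ xs) (∈-filter⁺ Q? (∈-allFin y) Qy)
  where
  xs : List (Fin k)
  xs = filter Q? (allFin k)

module Ancestry {m : ℕ} (par : Fin m → Maybe (Fin m)) (depth : Fin m → ℕ)
                (par-depth : ∀ u w → par u ≡ just w → depth u ≡ suc (depth w)) where

  infix 4 _≼_

  data _≼_ (u : Fin m) : Fin m → Set where
    ≼-refl  : u ≼ u
    ≼-child : ∀ {v w} → par v ≡ just w → u ≼ w → u ≼ v

  ≼-trans : ∀ {u v w} → u ≼ v → v ≼ w → u ≼ w
  ≼-trans u≼v ≼-refl = u≼v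
  ≼-trans u≼v (≼-child e v≼w) = ≼-child e (≼-trans u≼v v≼w)

  ≼⇒≡⊎depth< : ∀ {u v} → u ≼ v → u ≡ v ⊎ depth u < depth v
  ≼⇒≡⊎depth< ≼-refl = inj₁ refl
  ≼⇒≡⊎depth< (≼-child {v} {w} e u≼w) rewrite par-depth v w e with ≼⇒≡⊎depth< u≼w
  ... | inj₁ refl = inj₂ (n<1+n _)
  ... | inj₂ lt = inj₂ (<-trans lt (n<1+n _))

  ≼⇒depth≤ : ∀ {u v} → u ≼ v → depth u ≤ depth v
  ≼⇒depth≤ u≼v with ≼⇒≡⊎depth< u≼v
  ... | inj₁ refl = ≤-refl
  ... | inj₂ lt = <⇒≤ lt

  ≼∧≢⇒depth< : ∀ {u v} → u ≼ v → u ≢ v → depth u < depth v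
  ≼∧≢⇒depth< u≼v u≢v with ≼⇒≡⊎depth< u≼v
  ... | inj₁ u≡v = ⊥-elim (u≢v u≡v)
  ... | inj₂ lt = lt

  ≼∧depth≡⇒≡ : ∀ {u v} → u ≼ v → depth u ≡ depth v → u ≡ v
  ≼∧depth≡⇒≡ u≼v e with ≼⇒≡⊎depth< u≼v
  ... | inj₁ u≡v = u≡v
  ... | inj₂ lt = ⊥-elim (<-irrefl e lt)

  ≼-antisym : ∀ {u v} → u ≼ v → v ≼ u → u ≡ v
  ≼-antisym u≼v v≼u = ≼∧depth≡⇒≡ u≼v (≤-antisym (≼⇒depth≤ u≼v) (≼⇒depth≤ v≼u))

  ≼-parent : ∀ {u v p} → u ≼ v → u ≢ v → par v ≡ just p → u ≼ p
  ≼-parent ≼-refl u≢v _ = ⊥-elim (u≢v refl)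
  ≼-parent (≼-child e u≼w) _ e′ with trans (sym e′) e
  ... | refl = u≼w

  ancestors-comparable : ∀ {u v y} → u ≼ y → v ≼ y → u ≼ v ⊎ v ≼ u
  ancestors-comparable ≼-refl v≼y = inj₂ v≼y
  ancestors-comparable u≼y@(≼-child _ _) ≼-refl = inj₁ u≼y
  ancestors-comparable (≼-child e u≼w) (≼-child e′ v≼w′) with trans (sym e) e′
  ... | refl = ancestors-comparable u≼w v≼w′

  ≼?-bounded : ∀ k u v → depth v ≤ k → Dec (u ≼ v)
  ≼?-bounded k u v _ with u ≟ v
  ... | yes refl = yes ≼-refl
  ≼?-bounded k u v dv≤k | no u≢v with par v in e
  ... | nothing = no λ { ≼-refl → u≢v refl ; (≼-child e′ _) → nothing≢just (trans (sym e) e′) }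
  ... | just w with k | subst (_≤ k) (par-depth v w e) dv≤k
  ...   | suc k′ | s≤s dw≤k′ =
    map′ (≼-child e) (λ u≼v → ≼-parent u≼v u≢v e) (≼?-bounded k′ u w dw≤k′)

  _≼?_ : ∀ u v → Dec (u ≼ v)
  u ≼? v = ≼?-bounded (depth v) u v ≤-refl

module BurlingArcs (T : BurlingTree) where
  open BurlingTree T
  open Ancestry par depth par-depth
  open ≤-Reasoning

  branch-below-top : ∀ {s l y} → Chain par (s ∷ l) → y ∈ s ∷ l → s ≼ y
  branch-below-top ch (here refl) = ≼-refl
  branch-below-top (cons e ch) (there y∈l) = ≼-trans (≼-child e ≼-refl) (branch-below-top ch y∈l)

  branch-comparable : ∀ {s l y z} → Chain par (s ∷ l) → y ∈ s ∷ l → z ∈ s ∷ l → y ≼ z ⊎ z ≼ y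
  branch-comparable ch (here refl) z∈ = inj₁ (branch-below-top ch z∈)
  branch-comparable ch (there y∈) (here refl) = inj₂ (branch-below-top ch (there y∈))
  branch-comparable (cons _ ch) (there y∈) (there z∈) = branch-comparable ch y∈ z∈

  branch-convex : ∀ {s l q y} → Chain par (s ∷ l) → s ≼ q → q ≼ y → y ∈ s ∷ l → q ∈ s ∷ l
  branch-convex ch s≼q q≼y (here refl) = here (≼-antisym q≼y s≼q)
  branch-convex {q = q} (cons {y = t} e ch) s≼q q≼y (there y∈)
    with ancestors-comparable q≼y (branch-below-top ch y∈)
  ... | inj₂ t≼q = there (branch-convex ch t≼q q≼y y∈)
  ... | inj₁ q≼t with q ≟ t
  ...   | yes refl = there (here refl)
  ...   | no q≢t = here (≼-antisym (≼-parent q≼t q≢t e) s≼q)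

  record ArcShape (x y : Fin m) : Set where
    field
      p         : Fin m
      par-x     : par x ≡ just p
      ℓp≢x : ℓ p ≢ x
      rest      : List (Fin m)
      c-x       : c x ≡ ℓ p ∷ rest
      chain     : Chain par (ℓ p ∷ rest)
      y∈branch  : y ∈ ℓ p ∷ rest

    par-ℓp : par (ℓ p) ≡ just p
    par-ℓp = ℓ-child p x par-x

    depth-ℓp : depth (ℓ p) ≡ depth x
    depth-ℓp = trans (par-depth (ℓ p) p par-ℓp) (sym (par-depth x p par-x))

    ℓp≼y : ℓ p ≼ y
    ℓp≼y = branch-below-top chain y∈branch

  private
    ∉[] : ∀ {y : Fin m} → ¬ y ∈ []
    ∉[] ()

  arcShape : ∀ {x y} → y ∈ c x → ArcShape x y
  arcShape {x} {y} y∈cx with par x in par-x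
  ... | nothing = ⊥-elim (∉[] (subst (y ∈_) c-root (subst (λ r → y ∈ c r) (root-uniq x par-x) y∈cx)))
  ... | just p with ℓ p ≟ x
  ...   | yes ℓp≡x = ⊥-elim (∉[] (subst (y ∈_) (c-lastborn x p par-x ℓp≡x) y∈cx))
  ...   | no ℓp≢x = shape (c-branch x p par-x ℓp≢x) y∈cx refl
    where
    shape : ∀ {L} → BranchFrom par (ℓ p) L → y ∈ L → c x ≡ L → ArcShape x y
    shape (nonempty ch) y∈L cx≡L = record
      { p = p ; par-x = par-x ; ℓp≢x = ℓp≢x ; rest = _ ; c-x = cx≡L ; chain = ch ; y∈branch = y∈L }

  isLastBorn : Fin m → Bool
  isLastBorn x = maybe (λ p → does (ℓ p ≟ x)) false (par x)

  isLastBorn-child : ∀ {x p} → par x ≡ just p → isLastBorn x ≡ does (ℓ p ≟ x)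
  isLastBorn-child {x} = cong (maybe (λ p → does (ℓ p ≟ x)) false)

  -- The target of an arc from x is the last-born sibling of x or lies strictly deeper.
  rank : Fin m → ℕ
  rank x = 2 * depth x + bit (isLastBorn x)

  module _ {x y : Fin m} (y∈cx : y ∈ c x) where
    open ArcShape (arcShape y∈cx)

    source-⋠-target : ¬ x ≼ y
    source-⋠-target x≼y with ancestors-comparable x≼y ℓp≼y
    ... | inj₁ x≼ℓp = ℓp≢x (sym (≼∧depth≡⇒≡ x≼ℓp (sym depth-ℓp)))
    ... | inj₂ ℓp≼x = ℓp≢x (≼∧depth≡⇒≡ ℓp≼x depth-ℓp)

    target-⋠-source : ¬ y ≼ x
    target-⋠-source y≼x = ℓp≢x (≼∧depth≡⇒≡ (≼-trans ℓp≼y y≼x) depth-ℓp)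

    strict-ancestor-of-source-≼-target : ∀ {a} → a ≼ x → a ≢ x → a ≼ y
    strict-ancestor-of-source-≼-target a≼x a≢x =
      ≼-trans (≼-trans (≼-parent a≼x a≢x par-x) (≼-child par-ℓp ≼-refl)) ℓp≼y

    c-closed-under-ancestors : ∀ {a} → a ≼ y → ¬ a ≼ x → a ∈ c x
    c-closed-under-ancestors {a} a≼y a⋠x = subst (a ∈_) (sym c-x) a∈branch
      where
      a∈branch : a ∈ ℓ p ∷ rest
      a∈branch with ancestors-comparable a≼y ℓp≼y
      ... | inj₂ ℓp≼a = branch-convex chain ℓp≼a a≼y y∈branch
      ... | inj₁ a≼ℓp with a ≟ ℓ p
      ...   | yes a≡ℓp = here a≡ℓp
      ...   | no a≢ℓp = ⊥-elim (a⋠x (≼-child par-x (≼-parent a≼ℓp a≢ℓp par-ℓp)))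

    c-comparable : ∀ {z} → z ∈ c x → y ≼ z ⊎ z ≼ y
    c-comparable z∈cx = branch-comparable chain y∈branch (subst (_ ∈_) c-x z∈cx)

    rank-increasing : rank x < rank y
    rank-increasing with y ≟ ℓ p
    ... | yes y≡ℓp = begin-strict
      2 * depth x + bit (isLastBorn x)  ≡⟨ cong (λ b → 2 * depth x + bit b) x-not-last ⟩
      2 * depth x + 0                   <⟨ +-monoʳ-< (2 * depth x) (n<1+n 0) ⟩
      2 * depth x + 1                   ≡⟨ cong₂ (λ d b → 2 * d + bit b) (sym depth-ℓp) (sym ℓp-last) ⟩
      rank (ℓ p)                        ≡⟨ cong rank y≡ℓp ⟨
      rank y                            ∎
      where
      x-not-last : isLastBorn x ≡ false
      x-not-last = trans (isLastBorn-child par-x) (dec-false (ℓ p ≟ x) ℓp≢x)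
      ℓp-last : isLastBorn (ℓ p) ≡ true
      ℓp-last = trans (isLastBorn-child par-ℓp) (dec-true (ℓ p ≟ ℓ p) refl)
    ... | no y≢ℓp = begin-strict
      2 * depth x + bit (isLastBorn x)  ≤⟨ +-monoʳ-≤ (2 * depth x) (bit≤1 (isLastBorn x)) ⟩
      2 * depth x + 1                   <⟨ +-monoʳ-< (2 * depth x) (n<1+n 1) ⟩
      2 * depth x + 2                   ≡⟨ +-comm (2 * depth x) 2 ⟩
      2 + 2 * depth x                   ≡⟨ *-suc 2 (depth x) ⟨
      2 * suc (depth x)                 ≤⟨ *-monoʳ-≤ 2 depth-x<depth-y ⟩
      2 * depth y                       ≤⟨ m≤m+n (2 * depth y) _ ⟩
      rank y                            ∎
      where
      depth-x<depth-y : depth x < depth y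
      depth-x<depth-y = subst (_< depth y) depth-ℓp (≼∧≢⇒depth< ℓp≼y (λ ℓp≡y → y≢ℓp (sym ℓp≡y)))

module Climb {k : ℕ} (next : Fin k → Maybe (Fin k)) (μ : Fin k → ℕ)
             (μ-next : ∀ u w → next u ≡ just w → μ u < μ w) where

  bound : ℕ
  bound = max 0 (map μ (allFin k))

  μ≤bound : ∀ u → μ u ≤ bound
  μ≤bound u = All.lookup (All.map⁻ (xs≤max 0 (map μ (allFin k)))) (∈-allFin u)

  ascend : ℕ → Fin k → Fin k
  ascend zero u = u
  ascend (suc j) u = maybe (ascend j) u (next u)

  steps : ℕ → Fin k → ℕ
  steps zero u = 0
  steps (suc j) u = maybe (suc ∘ steps j) 0 (next u)

  ascend-stable : ∀ j u → next (ascend j u) ≡ nothing →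
                  ascend (suc j) u ≡ ascend j u × steps (suc j) u ≡ steps j u
  ascend-stable zero u stop rewrite stop = refl , refl
  ascend-stable (suc j) u stop with next u
  ... | nothing = refl , refl
  ... | just w with ascend-stable j w stop
  ...   | same-top , same-steps = same-top , cong suc same-steps

  ascend-stops : ∀ j u → bound < j + μ u → next (ascend j u) ≡ nothing
  ascend-stops zero u bound<μu = ⊥-elim (<-irrefl refl (<-≤-trans bound<μu (μ≤bound u)))
  ascend-stops (suc j) u (s≤s bound≤j+μu) with next u in e
  ... | nothing = e
  ... | just w = ascend-stops j w (≤-<-trans bound≤j+μu (+-monoʳ-< j (μ-next u w e)))

  ascend-avoids : ∀ {a} → (∀ u w → next u ≡ just w → w ≢ a) → ∀ j u → u ≢ a → ascend j u ≢ a
  ascend-avoids never-a zero u u≢a = u≢a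
  ascend-avoids never-a (suc j) u u≢a with next u in e
  ... | nothing = u≢a
  ... | just w = ascend-avoids never-a j w (never-a u w e)

  -- μ increases at every step and never exceeds bound, so bound + 1 steps reach a root.
  top : Fin k → Fin k
  top = ascend (suc bound)

  height : Fin k → ℕ
  height = steps (suc bound)

  next-top : ∀ u → next (top u) ≡ nothing
  next-top u = ascend-stops (suc bound) u (s≤s (m≤m+n bound (μ u)))

  top-fixed : ∀ u → next u ≡ nothing → top u ≡ u
  top-fixed u e rewrite e = refl

  private
    ascend-settled : ∀ u w → next u ≡ just w → next (ascend bound w) ≡ nothing
    ascend-settled u w e = ascend-stops bound w (m<m+n bound (≤-<-trans z≤n (μ-next u w e)))

  top-next : ∀ u w → next u ≡ just w → top u ≡ top w
  top-next u w e rewrite e = sym (proj₁ (ascend-stable bound w (ascend-settled u w e)))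

  height-next : ∀ u w → next u ≡ just w → height u ≡ suc (height w)
  height-next u w e rewrite e = cong suc (sym (proj₂ (ascend-stable bound w (ascend-settled u w e))))

  top-avoids : ∀ {a} → (∀ u w → next u ≡ just w → w ≢ a) → ∀ u → u ≢ a → top u ≢ a
  top-avoids never-a = ascend-avoids never-a (suc bound)

module Embedded (G : OGraph) (T : BurlingTree) (f : Fin (OGraph.n G) → Fin (BurlingTree.m T))
                (f-injective : Injective _≡_ _≡_ f)
                (arc⇔c : ∀ u w → (OGraph.arc G u w ≡ true ⇔ BurlingTree.DArc T (f u) (f w))) where
  open OGraph G
  open BurlingTree T using (depth)
  open Ancestry (BurlingTree.par T) depth (BurlingTree.par-depth T)
  open BurlingArcs T

  Outcome : Set
  Outcome = HasFullInStarCutset G ⊎ (IsOrientedChandelier G ⊎ HasVertexOfDegreeAtMost1 G)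

  module _ {u w : Fin n} (uw : arc u w ≡ true) where
    private
      fw∈cfu : f w ∈ BurlingTree.c T (f u)
      fw∈cfu = Equivalence.to (arc⇔c u w) uw

    arc-source-⋠ : ¬ f u ≼ f w
    arc-source-⋠ = source-⋠-target fw∈cfu

    arc-target-⋠ : ¬ f w ≼ f u
    arc-target-⋠ = target-⋠-source fw∈cfu

    arc-strict-ancestor : ∀ {v} → f v ≼ f u → v ≢ u → f v ≼ f w
    arc-strict-ancestor fv≼fu v≢u = strict-ancestor-of-source-≼-target fw∈cfu fv≼fu (v≢u ∘ f-injective)

    arc-ancestor : ∀ {v} → f v ≼ f w → ¬ f v ≼ f u → arc u v ≡ true
    arc-ancestor {v} fv≼fw fv⋠fu = Equivalence.from (arc⇔c u v) (c-closed-under-ancestors fw∈cfu fv≼fw fv⋠fu)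

    arc-comparable : ∀ {z} → arc u z ≡ true → f w ≼ f z ⊎ f z ≼ f w
    arc-comparable {z} uz = c-comparable fw∈cfu (Equivalence.to (arc⇔c u z) uz)

    arc-rank : rank (f u) < rank (f w)
    arc-rank = rank-increasing fw∈cfu

  adj⇒arc⊎arc : ∀ {u w} → adj G u w ≡ true → arc u w ≡ true ⊎ arc w u ≡ true
  adj⇒arc⊎arc {u} {w} uw with arc u w
  ... | true = inj₁ refl
  ... | false = inj₂ uw

  arc-asym : ∀ {u w} → arc u w ≡ true → arc w u ≡ true → ⊥
  arc-asym {u} {w} uw wu = not-¬ (antisym u w uw) wu

  arc? : ∀ u w → Dec (arc u w ≡ true)
  arc? u w = arc u w ≟ᴮ true

  _≟ᴹ_ : (x y : Maybe (Fin n)) → Dec (x ≡ y)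
  _≟ᴹ_ = ≡-decᴹ _≟_

  ∃-source : Fin n → ∃[ s ] ∀ x → arc x s ≡ false
  ∃-source u₀ = s , λ x → ¬-not λ xs → <-irrefl refl (<-≤-trans (arc-rank xs) (s-minimal x))
    where
    s : Fin n
    s = argmin (rank ∘ f) u₀ (allFin n)
    s-minimal : ∀ x → rank (f s) ≤ rank (f x)
    s-minimal x = All.lookup (f[argmin]≤f[xs] u₀ (allFin n)) (∈-allFin x)

  antichain⇒degree≤1 : Fin n → (∀ u w → f u ≼ f w → u ≡ w) → HasVertexOfDegreeAtMost1 G
  antichain⇒degree≤1 u₀ antichain with ∃-source u₀
  ... | s , s-source = s , degree≤1 G s λ u w su sw → out-neighbours-equal (out su) (out sw)
    where
    out : ∀ {u} → adj G s u ≡ true → arc s u ≡ true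
    out {u} su with adj⇒arc⊎arc su
    ... | inj₁ s→u = s→u
    ... | inj₂ u→s = ⊥-elim (not-¬ (s-source u) u→s)
    out-neighbours-equal : ∀ {u w} → arc s u ≡ true → arc s w ≡ true → u ≡ w
    out-neighbours-equal su sw with arc-comparable su sw
    ... | inj₁ fu≼fw = antichain _ _ fu≼fw
    ... | inj₂ fw≼fu = sym (antichain _ _ fw≼fu)

  module Deepest (a b : Fin n) (b≢a : b ≢ a) (fa≼fb : f a ≼ f b)
                 (deepest : ∀ y z → z ≢ y → f y ≼ f z → depth (f y) ≤ depth (f a)) where

    Below : Fin n → Set
    Below u = f a ≼ f u

    Below? : ∀ u → Dec (Below u)
    Below? u = f a ≼? f u

    Remaining : Fin n → Set
    Remaining u = ¬ InClosedInNbhd G a u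

    outside-≢a : ∀ {u} → ¬ Below u → u ≢ a
    outside-≢a not-below-u refl = not-below-u ≼-refl

    remaining-≢ : ∀ {u} → Remaining u → u ≢ a
    remaining-≢ rem u≡a = rem (inj₁ u≡a)

    reach-remaining : ∀ {s t} → Reach G Remaining s t → Remaining t
    reach-remaining (here rem) = rem
    reach-remaining (step _ _ rem) = rem

    below-antichain : ∀ {u w} → u ≢ a → Below u → f u ≼ f w → u ≡ w
    below-antichain {u} {w} u≢a fa≼fu fu≼fw with w ≟ u
    ... | yes w≡u = sym w≡u
    ... | no w≢u = ⊥-elim (<-irrefl refl (<-≤-trans fa-above-fu (deepest u w w≢u fu≼fw)))
      where
      fa-above-fu : depth (f a) < depth (f u)
      fa-above-fu = ≼∧≢⇒depth< fa≼fu (u≢a ∘ sym ∘ f-injective)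

    reach-stays-below : ∀ {s t} → Below s → Reach G Remaining s t → Below t
    reach-stays-below below-s (here _) = below-s
    reach-stays-below below-s (step {t} {d} r td rem-d) = step-below (Below? d) (adj⇒arc⊎arc td)
      where
      below-t : Below t
      below-t = reach-stays-below below-s r
      a≢t : a ≢ t
      a≢t = remaining-≢ (reach-remaining r) ∘ sym
      step-below : Dec (Below d) → arc t d ≡ true ⊎ arc d t ≡ true → Below d
      step-below (yes below-d) _ = below-d
      step-below (no not-below-d) (inj₁ t→d) = ⊥-elim (not-below-d (arc-strict-ancestor t→d below-t a≢t))
      step-below (no not-below-d) (inj₂ d→t) = ⊥-elim (rem-d (inj₂ (arc-ancestor d→t below-t not-below-d)))

    b-remaining : Remaining b
    b-remaining (inj₁ b≡a) = b≢a b≡a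
    b-remaining (inj₂ b→a) = arc-target-⋠ b→a fa≼fb

    non-in-neighbour⇒cutset : ∀ e → ¬ Below e → ¬ arc e a ≡ true → FullInStarCutset G a
    non-in-neighbour⇒cutset e not-below-e e↛a =
      b , e , b-remaining , e-remaining , λ r → not-below-e (reach-stays-below fa≼fb r)
      where
      e-remaining : Remaining e
      e-remaining (inj₁ e≡a) = outside-≢a not-below-e e≡a
      e-remaining (inj₂ e→a) = e↛a e→a

    module AllOutsideIn (outside→a : ∀ e → ¬ Below e → arc e a ≡ true) where

      a-no-out : ∀ u → arc a u ≡ false
      a-no-out u = ¬-not λ a→u → arc-asym a→u (outside→a u (arc-source-⋠ a→u))

      out-below : ∀ {u w} → arc u w ≡ true → w ≢ a → Below w
      out-below {u} {w} u→w w≢a with u ≟ a | Below? u | Below? w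
      ... | _ | _ | yes below-w = below-w
      ... | yes refl | _ | no _ = ⊥-elim (not-¬ (a-no-out w) u→w)
      ... | no u≢a | yes below-u | no _ = arc-strict-ancestor u→w below-u (u≢a ∘ sym)
      ... | no _ | no not-below-u | no not-below-w with arc-comparable u→w (outside→a u not-below-u)
      ...   | inj₁ fw≼fa = ⊥-elim (arc-source-⋠ (outside→a w not-below-w) fw≼fa)
      ...   | inj₂ fa≼fw = fa≼fw

      out-unique : ∀ {u w w′} → arc u w ≡ true → arc u w′ ≡ true → w ≢ a → w′ ≢ a → w ≡ w′
      out-unique u→w u→w′ w≢a w′≢a with arc-comparable u→w u→w′
      ... | inj₁ fw≼fw′ = below-antichain w≢a (out-below u→w w≢a) fw≼fw′
      ... | inj₂ fw′≼fw = sym (below-antichain w′≢a (out-below u→w′ w′≢a) fw′≼fw)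

      UpArc : Fin n → Fin n → Set
      UpArc u w = w ≢ a × arc u w ≡ true

      UpArc? : ∀ u w → Dec (UpArc u w)
      UpArc? u w = ¬? (w ≟ a) ×-dec arc? u w

      -- By out-unique, G − a is the in-forest with parent map up.
      up : Fin n → Maybe (Fin n)
      up u with any? (UpArc? u)
      ... | yes (w , _) = just w
      ... | no _ = nothing

      up-arc : ∀ {u w} → up u ≡ just w → UpArc u w
      up-arc {u} e with any? (UpArc? u)
      ... | yes (w′ , uw′) = subst (UpArc u) (just-injective e) uw′

      up-nothing : ∀ {u w} → up u ≡ nothing → UpArc u w → ⊥
      up-nothing {u} {w} e uw with any? (UpArc? u)
      ... | no none = none (w , uw)

      arc-up : ∀ {u w} → UpArc u w → up u ≡ just w
      arc-up {u} (w≢a , u→w) with any? (UpArc? u)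
      ... | yes (w′ , w′≢a , u→w′) = cong just (out-unique u→w′ u→w w′≢a w≢a)
      ... | no none = ⊥-elim (none (_ , w≢a , u→w))

      up-≢a : ∀ u w → up u ≡ just w → w ≢ a
      up-≢a u w e = proj₁ (up-arc e)

      up-source-≢a : ∀ {w u} → up w ≡ just u → w ≢ a
      up-source-≢a {w} {u} up-w w≡a =
        not-¬ (a-no-out u) (subst (λ v → arc v u ≡ true) w≡a (proj₂ (up-arc up-w)))

      up-rank : ∀ u w → up u ≡ just w → rank (f u) < rank (f w)
      up-rank u w e = arc-rank (proj₂ (up-arc e))

      a-neighbours-outside : ∀ {u} → adj G a u ≡ true → ¬ Below u
      a-neighbours-outside au with adj⇒arc⊎arc au
      ... | inj₁ a→u = arc-source-⋠ a→u
      ... | inj₂ u→a = arc-target-⋠ u→a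

      one-outside⇒degree≤1 : (∀ x y → ¬ Below x → ¬ Below y → x ≡ y) → HasVertexOfDegreeAtMost1 G
      one-outside⇒degree≤1 unique = a , degree≤1 G a λ u w au aw →
        unique u w (a-neighbours-outside au) (a-neighbours-outside aw)

      outside-root⇒degree≤1 : ∀ x → ¬ Below x → up x ≡ nothing → HasVertexOfDegreeAtMost1 G
      outside-root⇒degree≤1 x not-below-x up-x =
        x , degree≤1 G x λ u w xu xw → trans (only-a xu) (sym (only-a xw))
        where
        only-a : ∀ {u} → adj G x u ≡ true → u ≡ a
        only-a {u} xu with u ≟ a | adj⇒arc⊎arc xu
        ... | yes u≡a | _ = u≡a
        ... | no u≢a | inj₁ x→u = ⊥-elim (up-nothing up-x (u≢a , x→u))
        ... | no u≢a | inj₂ u→x = ⊥-elim (not-below-x (out-below u→x (outside-≢a not-below-x)))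

      childless⇒degree≤1 : ∀ u → u ≢ a → Below u → (∀ w → up w ≢ just u) → HasVertexOfDegreeAtMost1 G
      childless⇒degree≤1 u u≢a below-u childless = u , degree≤1 G u λ w w′ uw uw′ →
        just-injective (trans (sym (parent uw)) (parent uw′))
        where
        parent : ∀ {w} → adj G u w ≡ true → up u ≡ just w
        parent {w} uw with w ≟ a | adj⇒arc⊎arc uw
        ... | yes refl | inj₁ u→a = ⊥-elim (arc-target-⋠ u→a below-u)
        ... | yes refl | inj₂ a→u = ⊥-elim (arc-source-⋠ a→u below-u)
        ... | no w≢a | inj₁ u→w = arc-up (w≢a , u→w)
        ... | no w≢a | inj₂ w→u = ⊥-elim (childless w (arc-up (u≢a , w→u)))

      module Forest (outside-has-up : ∀ x → ¬ Below x → ∃[ w ] up x ≡ just w) where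
        open Climb up (rank ∘ f) up-rank

        rt : Fin n
        rt = top b

        root-remaining : ∀ {r} → r ≢ a → up r ≡ nothing → Remaining r
        root-remaining r≢a _ (inj₁ r≡a) = r≢a r≡a
        root-remaining {r} _ up-r (inj₂ r→a) with outside-has-up r (arc-target-⋠ r→a)
        ... | _ , up-r≡just = nothing≢just (trans (sym up-r) up-r≡just)

        reach-same-top : ∀ {t} → Reach G Remaining rt t → top t ≡ rt
        reach-same-top (here _) = top-fixed rt (next-top b)
        reach-same-top (step {t} {d} r td rem-d) with adj⇒arc⊎arc td
        ... | inj₁ t→d = trans (sym (top-next t d (arc-up (remaining-≢ rem-d , t→d)))) (reach-same-top r)
        ... | inj₂ d→t = trans (top-next d t (arc-up (remaining-≢ (reach-remaining r) , d→t))) (reach-same-top r)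

        second-root⇒cutset : ∀ ρ → ρ ≢ a → up ρ ≡ nothing → ρ ≢ rt → FullInStarCutset G a
        second-root⇒cutset ρ ρ≢a up-ρ ρ≢rt =
          rt , ρ , root-remaining rt≢a (next-top b) , root-remaining ρ≢a up-ρ ,
          λ r → ρ≢rt (trans (sym (top-fixed ρ up-ρ)) (reach-same-top r))
          where
          rt≢a : rt ≢ a
          rt≢a = top-avoids up-≢a b b≢a

        IsLeaf : Fin n → Set
        IsLeaf u = u ≢ a × (∀ w → w ≢ a → up w ≢ just u) × (∃[ w ] up u ≡ just w)

        outside-leaf : ∀ {u} → ¬ Below u → IsLeaf u
        outside-leaf {u} not-below-u =
          u≢a , (λ w _ up-w → not-below-u (out-below (proj₂ (up-arc up-w)) u≢a)) , outside-has-up u not-below-u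
          where
          u≢a : u ≢ a
          u≢a = outside-≢a not-below-u

        module _ (below-has-child : ∀ u → u ≢ a → Below u → ∃[ w ] up w ≡ just u) where

          leaf-in-neighbour : ∀ u → IsLeaf u → arc u a ≡ true
          leaf-in-neighbour u (u≢a , childless , _) with Below? u
          ... | no not-below-u = outside→a u not-below-u
          ... | yes below-u with below-has-child u u≢a below-u
          ...   | w , up-w = ⊥-elim (childless w (up-source-≢a up-w) up-w)

          single-root⇒chandelier : (∀ u → u ≢ a → up u ≡ nothing → u ≡ rt) →
                                   ∀ x y → x ≢ y → ¬ Below x → ¬ Below y → ChandelierData G a
          single-root⇒chandelier single-root x y x≢y not-below-x not-below-y = record
            { par        = up
            ; rt         = rt
            ; depth      = height
            ; rt≢v       = top-avoids up-≢a b b≢a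
            ; par-rt     = next-top b
            ; par-root   = single-root
            ; par-in     = λ u w _ → up-≢a u w
            ; par-depth  = λ u w _ → height-next u w
            ; arcs-tree  = λ u w _ w≢a → mk⇔ (λ u→w → arc-up (w≢a , u→w)) (proj₂ ∘ up-arc)
            ; two-leaves = x , y , x≢y , outside-leaf not-below-x , outside-leaf not-below-y
            ; v-no-out   = a-no-out
            ; v-in       = λ u _ → mk⇔ (outside-leaf ∘ arc-target-⋠) (leaf-in-neighbour u)
            }

          forest-outcome : ∀ x y → x ≢ y → ¬ Below x → ¬ Below y → Outcome
          forest-outcome x y x≢y not-below-x not-below-y
            with any? (λ ρ → ¬? (ρ ≟ a) ×-dec (up ρ ≟ᴹ nothing) ×-dec ¬? (ρ ≟ rt))
          ... | yes (ρ , ρ≢a , up-ρ , ρ≢rt) = inj₁ (a , second-root⇒cutset ρ ρ≢a up-ρ ρ≢rt)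
          ... | no no-second-root =
            inj₂ (inj₁ (a , single-root⇒chandelier single-root x y x≢y not-below-x not-below-y))
            where
            single-root : ∀ u → u ≢ a → up u ≡ nothing → u ≡ rt
            single-root u u≢a up-u = decidable-stable (u ≟ rt) λ u≢rt → no-second-root (u , u≢a , up-u , u≢rt)

      outcome : Outcome
      outcome with any? (λ x → ¬? (Below? x) ×-dec (up x ≟ᴹ nothing))
      ... | yes (x , not-below-x , up-x) = inj₂ (inj₂ (outside-root⇒degree≤1 x not-below-x up-x))
      ... | no no-outside-root
        with any? (λ u → ¬? (u ≟ a) ×-dec Below? u ×-dec ¬? (any? λ w → up w ≟ᴹ just u))
      ...   | yes (u , u≢a , below-u , childless) =
        inj₂ (inj₂ (childless⇒degree≤1 u u≢a below-u λ w up-w → childless (w , up-w)))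
      ...   | no no-childless
        with any? (λ x → any? λ y → ¬? (x ≟ y) ×-dec ¬? (Below? x) ×-dec ¬? (Below? y))
      ...     | yes (x , y , x≢y , not-below-x , not-below-y) =
        Forest.forest-outcome outside-has-up below-has-child x y x≢y not-below-x not-below-y
        where
        outside-has-up : ∀ x → ¬ Below x → ∃[ w ] up x ≡ just w
        outside-has-up x not-below-x with up x in up-x
        ... | just w = w , refl
        ... | nothing = ⊥-elim (no-outside-root (x , not-below-x , up-x))
        below-has-child : ∀ u → u ≢ a → Below u → ∃[ w ] up w ≡ just u
        below-has-child u u≢a below-u = decidable-stable (any? λ w → up w ≟ᴹ just u)
          λ childless → no-childless (u , u≢a , below-u , childless)
      ...     | no at-most-one-outside = inj₂ (inj₂ (one-outside⇒degree≤1 unique))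
        where
        unique : ∀ x y → ¬ Below x → ¬ Below y → x ≡ y
        unique x y not-below-x not-below-y =
          decidable-stable (x ≟ y) λ x≢y → at-most-one-outside (x , y , x≢y , not-below-x , not-below-y)

    outcome : Outcome
    outcome with any? (λ e → ¬? (Below? e) ×-dec ¬? (arc? e a))
    ... | yes (e , not-below-e , e↛a) = inj₁ (a , non-in-neighbour⇒cutset e not-below-e e↛a)
    ... | no none = AllOutsideIn.outcome λ e not-below-e →
      decidable-stable (arc? e a) λ e↛a → none (e , not-below-e , e↛a)

  HasProperDescendant : Fin n → Set
  HasProperDescendant a = ∃[ b ] b ≢ a × f a ≼ f b

  HasProperDescendant? : ∀ a → Dec (HasProperDescendant a)
  HasProperDescendant? a = any? λ b → ¬? (b ≟ a) ×-dec (f a ≼? f b)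

  outcome : Fin n → Outcome
  outcome u₀ with any? HasProperDescendant?
  ... | no none = inj₂ (inj₂ (antichain⇒degree≤1 u₀ antichain))
    where
    antichain : ∀ u w → f u ≼ f w → u ≡ w
    antichain u w fu≼fw = sym (decidable-stable (w ≟ u) λ w≢u → none (u , w , w≢u , fu≼fw))
  ... | yes some with ∃-maximal HasProperDescendant? (depth ∘ f) some
  ...   | a , (b , b≢a , fa≼fb) , deepest =
    Deepest.outcome a b b≢a fa≼fb λ y z z≢y fy≼fz → deepest y (z , z≢y , fy≼fz)

theorem5p5 : (G : OGraph) → 0 < OGraph.n G → IsOrientedBurlingGraph G →
    HasFullInStarCutset G ⊎ (IsOrientedChandelier G ⊎ HasVertexOfDegreeAtMost1 G)
theorem5p5 G 0<n (T , f , f-injective , arc⇔c) = Embedded.outcome G T f f-injective arc⇔c (fromℕ< 0<n)
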